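{- There is a deterministic distributed algorithm in the LOCAL model that, on any graph with maximum degree $\Delta$, computes in $O(\log\Delta)$ rounds a $2^{ -\lceil\log \Delta\rceil}$-fractional $4$-approximate maximum matching.
   Context: LOCAL model: the network is an undirected simple graph $G=(V,E)$ with maximum degree $\Delta$; each node has a unique identifier; synchronous rounds, in each of which each node does local computation and sends a message of arbitrary size to each neighbor. All nodes know $\log\Delta$ up to a constant factor. For $v\in V$ let $E(v)$ be the set of edges incident to $v$. A fractional matching is an assignment $x_e\in[0,1]$ to edges with $c_v:=\sum_{e\in E(v)}x_e\le 1$ for all $v$. It is $2^{ -i}$-fractional ($i\in\mathbb{N}$) if every $x_e\in\{0\}\cup\{2^{ -j}:0\le j\le i\}$. For $c>1$, it is $c$-approximate if $c\sum_{e\in E}x_e\ge|M^*|$ for a maximum (cardinality) matching $M^*$ of $G$. Logarithms are base 2. -}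

module Defs where

open import Data.Nat as ℕ using (ℕ; zero; suc; _⊔_)
open import Data.Nat.Logarithm using (⌈log₂_⌉)
open import Data.Bool using (Bool; true; false; if_then_else_)
open import Data.Fin as Fin using (Fin; _<?_)
open import Data.List using (List; []; _∷_; map; foldr; length; allFin; filter; concatMap)
open import Data.List.Relation.Unary.All using (All)
open import Data.List.Relation.Unary.Unique.Propositional using (Unique)
open import Data.Maybe using (Maybe; just; nothing)
open import Data.Product using (Σ; ∃; _×_; _,_; proj₁; proj₂)
open import Data.Sum using (_⊎_)
open import Data.Integer using (+_)
open import Data.Rational as ℚ using (ℚ; 0ℚ; 1ℚ; ½; _/_)
open import Function using (Injective)
open import Relation.Binary.PropositionalEquality using (_≡_)
open import Relation.Nullary using (¬_)

record Graph (n : ℕ) : Set where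
  field
    E     : Fin n → Fin n → Bool
    sym   : ∀ u v → E u v ≡ E v u
    irrefl : ∀ v → E v v ≡ false

open Graph public

deg : ∀ {n} → Graph n → Fin n → ℕ
deg {n} G v = length (Data.List.filterᵇ (E G v) (allFin n))

maxDeg : ∀ {n} → Graph n → ℕ
maxDeg {n} G = foldr _⊔_ 0 (map (deg G) (allFin n))

-- Port numbering: at node v, ports Fin (deg v) are in bijection with the
-- neighbours of v; 'back v p' is the port at the neighbour leading back to v.

record PortNumbering {n} (G : Graph n) : Set where
  field
    nbr      : (v : Fin n) → Fin (deg G v) → Fin n
    nbr-adj  : ∀ v p → E G v (nbr v p) ≡ true
    nbr-inj  : ∀ v → Injective _≡_ _≡_ (nbr v)
    nbr-surj : ∀ v u → E G v u ≡ true → ∃ λ p → nbr v p ≡ u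
    back     : (v : Fin n) (p : Fin (deg G v)) → Fin (deg G (nbr v p))
    back-ok  : ∀ v p → nbr (nbr v p) (back v p) ≡ v

open PortNumbering public

-- A node initially knows: the common value Λ (approximation of log Δ),
-- its own identifier and its degree (number of ports).
-- 'output d s = just x' means the node has halted with output x(p) ∈ ℚ
-- for the edge at port p.  Halted nodes keep their state.

record LocalAlgorithm : Set₁ where
  field
    State  : Set
    Msg    : Set
    init   : (Λ : ℕ) (ident : ℕ) (d : ℕ) → State
    send   : (d : ℕ) → State → Fin d → Msg
    update : (d : ℕ) → State → (Fin d → Msg) → State
    output : (d : ℕ) → State → Maybe (Fin d → ℚ)

open LocalAlgorithm public

module Run (A : LocalAlgorithm) {n : ℕ} (G : Graph n) (P : PortNumbering G)
           (ID : Fin n → ℕ) (Λ : ℕ) where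

  step : (v : Fin n) → Maybe (Fin (deg G v) → ℚ) → State A →
         (Fin (deg G v) → Msg A) → State A
  step v (just _) s m = s
  step v nothing  s m = update A (deg G v) s m

  state : ℕ → (v : Fin n) → State A
  state zero    v = init A Λ (ID v) (deg G v)
  state (suc r) v =
    step v (output A (deg G v) (state r v)) (state r v)
      (λ p → send A (deg G (nbr P v p)) (state r (nbr P v p)) (back P v p))

  out : ℕ → (v : Fin n) → Maybe (Fin (deg G v) → ℚ)
  out r v = output A (deg G v) (state r v)

sumℚ : List ℚ → ℚ
sumℚ = foldr ℚ._+_ 0ℚ

pow½ : ℕ → ℚ
pow½ zero    = 1ℚ
pow½ (suc j) = ½ ℚ.* pow½ j

fromℕℚ : ℕ → ℚ
fromℕℚ k = (+ k) / 1

module Assignment {n : ℕ} (G : Graph n) (P : PortNumbering G)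
                  (x : (v : Fin n) → Fin (deg G v) → ℚ) where

  Consistent : Set
  Consistent = ∀ v p → x (nbr P v p) (back P v p) ≡ x v p

  load : Fin n → ℚ
  load v = sumℚ (map (x v) (allFin (deg G v)))

  IsFractionalMatching : Set
  IsFractionalMatching = (∀ v p → 0ℚ ℚ.≤ x v p × x v p ℚ.≤ 1ℚ)
                       × (∀ v → load v ℚ.≤ 1ℚ)

  IsPowFractional : ℕ → Set
  IsPowFractional i = ∀ v p → x v p ≡ 0ℚ ⊎ (∃ λ j → j ℕ.≤ i × x v p ≡ pow½ j)

  -- Σ_{e ∈ E} x_e : each edge {v,u} counted once, at its endpoint v with v < u
  total : ℚ
  total = sumℚ (concatMap (λ v → map (x v)
            (filter (λ p → v <? nbr P v p) (allFin (deg G v)))) (allFin n))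

endpoints : ∀ {n} → List (Fin n × Fin n) → List (Fin n)
endpoints = concatMap (λ e → proj₁ e ∷ proj₂ e ∷ [])

IsMatching : ∀ {n} → Graph n → List (Fin n × Fin n) → Set
IsMatching G M = All (λ e → E G (proj₁ e) (proj₂ e) ≡ true) M × Unique (endpoints M)

IsMaximumMatching : ∀ {n} → Graph n → List (Fin n × Fin n) → Set
IsMaximumMatching G M =
  IsMatching G M × (∀ M′ → IsMatching G M′ → length M′ ℕ.≤ length M)

module Submission where

-- Every edge {u,v} carries a
-- value 2^{-e} with e = ⌈log₂ max(deg u, deg v)⌉ initially, so every load
-- c_v = Σ_{e ∈ E(v)} x_e is at most 1.  Then, in each of K = κΛ + 1 ≥ ⌈log₂ Δ⌉ + 1
-- phases, every edge both of whose endpoints are "light" (load < ½) doubles its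
-- value.  Doubling keeps every load ≤ 1, an edge whose value is 1 makes its
-- endpoints heavy, and exponents never grow; hence after K phases every edge has
-- a heavy endpoint.  Summing loads over the endpoints of a maximum matching M
-- then gives |M|/2 ≤ Σ_v c_v = 2 Σ_e x_e, i.e. the 4-approximation.

open import Defs hiding (sym)
open import Data.Nat as ℕ using (ℕ; zero; suc; _⊔_; _∸_; _^_; z≤n; s≤s)
import Data.Nat.Properties as ℕ
open import Data.Nat.Induction using (<-rec)
open import Data.Nat.Logarithm
  using (⌈log₂_⌉; ⌈log₂⌉-mono-≤; ⌈log₂2^n⌉≡n; ⌈log₂⌈n/2⌉⌉≡⌈log₂n⌉∸1)
import Data.Nat.Coprimality as Coprime
import Data.Integer as ℤ
import Data.Integer.Properties as ℤ
open import Data.Fin as Fin using (Fin; toℕ; fromℕ<; _≟_; _<?_)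
import Data.Fin.Properties as Fin
open import Data.List using (List; []; _∷_; map; foldr; allFin; filter; concatMap; _++_; length)
open import Data.List.Properties using (map-cong; map-tabulate)
open import Data.List.Relation.Unary.All as All using (All; []; _∷_)
open import Data.List.Relation.Unary.Any using (here; there)
open import Data.List.Relation.Unary.AllPairs using ([]; _∷_)
open import Data.List.Relation.Unary.Unique.Propositional using (Unique)
open import Data.List.Membership.Propositional using (_∈_)
open import Data.List.Membership.Propositional.Properties using (∈-allFin)
open import Data.Bool using (Bool; true; false; if_then_else_; _∧_)
open import Data.Bool.Properties using (∧-comm)
open import Data.Maybe using (just; nothing)
open import Data.Product using (Σ; ∃; _×_; _,_; proj₁; proj₂)
open import Data.Sum using (_⊎_; inj₁; inj₂)
open import Data.Empty using (⊥-elim)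
open import Data.Unit using (tt)
open import Data.Rational as ℚ using (ℚ; 0ℚ; 1ℚ; ½; _+_; _*_; _≤_; _<_)
import Data.Rational.Properties as ℚ
open import Data.Rational.Solver using (module +-*-Solver)
open import Algebra.Bundles using (CommutativeMonoid)
open import Algebra.Properties.CommutativeSemigroup
  (CommutativeMonoid.commutativeSemigroup ℚ.+-0-commutativeMonoid) using (interchange)
open import Function using (_∘_; id; Injective)
open import Relation.Binary.PropositionalEquality
open import Relation.Binary.Definitions using (tri<; tri≈; tri>)
open import Relation.Nullary using (¬_; Dec; yes; no; does)
open import Relation.Nullary.Decidable using (dec-true; dec-false)

∑ : {A : Set} → List A → (A → ℚ) → ℚ
∑ xs f = sumℚ (map f xs)

∑Fin : (d : ℕ) → (Fin d → ℚ) → ℚ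
∑Fin d = ∑ (allFin d)

∑-cong : ∀ {A : Set} (xs : List A) {f g : A → ℚ} → (∀ a → f a ≡ g a) → ∑ xs f ≡ ∑ xs g
∑-cong xs f≗g = cong sumℚ (map-cong f≗g xs)

∑-congᴬ : ∀ {A : Set} {xs : List A} {f g : A → ℚ} → All (λ a → f a ≡ g a) xs → ∑ xs f ≡ ∑ xs g
∑-congᴬ []             = refl
∑-congᴬ (fa≡ga ∷ rest) = cong₂ _+_ fa≡ga (∑-congᴬ rest)

∑-zero : ∀ {A : Set} (xs : List A) → ∑ xs (λ _ → 0ℚ) ≡ 0ℚ
∑-zero []       = refl
∑-zero (_ ∷ xs) = trans (ℚ.+-identityˡ _) (∑-zero xs)

∑-+ : ∀ {A : Set} (xs : List A) (f g : A → ℚ) → ∑ xs (λ a → f a + g a) ≡ ∑ xs f + ∑ xs g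
∑-+ []       f g = refl
∑-+ (a ∷ xs) f g =
  trans (cong (f a + g a +_) (∑-+ xs f g)) (interchange (f a) (g a) (∑ xs f) (∑ xs g))

∑-*ˡ : ∀ {A : Set} (xs : List A) (c : ℚ) (f : A → ℚ) → ∑ xs (λ a → c * f a) ≡ c * ∑ xs f
∑-*ˡ []       c f = sym (ℚ.*-zeroʳ c)
∑-*ˡ (a ∷ xs) c f = trans (cong (c * f a +_) (∑-*ˡ xs c f)) (sym (ℚ.*-distribˡ-+ c (f a) _))

∑-swap : ∀ {A B : Set} (xs : List A) (ys : List B) (f : A → B → ℚ) →
  ∑ xs (λ a → ∑ ys (f a)) ≡ ∑ ys (λ b → ∑ xs (λ a → f a b))
∑-swap []       ys f = sym (∑-zero ys)
∑-swap (a ∷ xs) ys f =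
  trans (cong (∑ ys (f a) +_) (∑-swap xs ys f)) (sym (∑-+ ys (f a) (λ b → ∑ xs (λ a′ → f a′ b))))

sumℚ-++ : (qs rs : List ℚ) → sumℚ (qs ++ rs) ≡ sumℚ qs + sumℚ rs
sumℚ-++ []       rs = sym (ℚ.+-identityˡ _)
sumℚ-++ (q ∷ qs) rs = trans (cong (q +_) (sumℚ-++ qs rs)) (sym (ℚ.+-assoc q _ _))

∑-concatMap : ∀ {A : Set} (xs : List A) (g : A → List ℚ) →
  sumℚ (concatMap g xs) ≡ ∑ xs (sumℚ ∘ g)
∑-concatMap []       g = refl
∑-concatMap (a ∷ xs) g =
  trans (sumℚ-++ (g a) (concatMap g xs)) (cong (sumℚ (g a) +_) (∑-concatMap xs g))

∑-filter : ∀ {A : Set} {P : A → Set} (P? : ∀ a → Dec (P a)) (xs : List A) (f : A → ℚ) →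
  ∑ (filter P? xs) f ≡ ∑ xs (λ a → if does (P? a) then f a else 0ℚ)
∑-filter P? []       f = refl
∑-filter P? (a ∷ xs) f with does (P? a)
... | true  = cong (f a +_) (∑-filter P? xs f)
... | false = trans (∑-filter P? xs f) (sym (ℚ.+-identityˡ _))

∑-mono : ∀ {A : Set} (xs : List A) {f g : A → ℚ} → (∀ a → f a ≤ g a) → ∑ xs f ≤ ∑ xs g
∑-mono []       f≤g = ℚ.≤-refl
∑-mono (a ∷ xs) f≤g = ℚ.+-mono-≤ (f≤g a) (∑-mono xs f≤g)

∑-nonneg : ∀ {A : Set} (xs : List A) {f : A → ℚ} → (∀ a → 0ℚ ≤ f a) → 0ℚ ≤ ∑ xs f
∑-nonneg xs {f} f≥0 = subst (_≤ ∑ xs f) (∑-zero xs) (∑-mono xs f≥0)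

term≤∑ : ∀ {A : Set} {xs : List A} {f : A → ℚ} {a : A} → (∀ b → 0ℚ ≤ f b) → a ∈ xs → f a ≤ ∑ xs f
term≤∑ {xs = b ∷ xs} {f} f≥0 (here refl) =
  subst (_≤ f b + ∑ xs f) (ℚ.+-identityʳ (f b)) (ℚ.+-monoʳ-≤ (f b) (∑-nonneg xs f≥0))
term≤∑ {xs = b ∷ xs} {f} f≥0 (there a∈xs) =
  subst (_≤ f b + ∑ xs f) (ℚ.+-identityˡ _) (ℚ.+-mono-≤ (f≥0 b) (term≤∑ f≥0 a∈xs))

∑Fin-suc : ∀ d (f : Fin (suc d) → ℚ) → ∑Fin (suc d) f ≡ f Fin.zero + ∑Fin d (f ∘ Fin.suc)
∑Fin-suc d f = cong (λ qs → f Fin.zero + sumℚ qs)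
  (trans (map-tabulate Fin.suc f) (sym (map-tabulate id (f ∘ Fin.suc))))

δ : ∀ {d} → Fin d → Fin d → ℚ → ℚ
δ a u c = if does (a ≟ u) then c else 0ℚ

δ-≡ : ∀ {d} {a u : Fin d} {c} → a ≡ u → δ a u c ≡ c
δ-≡ {a = a} {u} a≡u rewrite dec-true (a ≟ u) a≡u = refl

δ-≢ : ∀ {d} {a u : Fin d} {c} → ¬ a ≡ u → δ a u c ≡ 0ℚ
δ-≢ {a = a} {u} a≢u rewrite dec-false (a ≟ u) a≢u = refl

∑Fin-δ : ∀ d (a : Fin d) (h : Fin d → ℚ) → ∑Fin d (λ u → δ a u (h u)) ≡ h a
∑Fin-δ (suc d) Fin.zero h = begin
    ∑Fin (suc d) (λ u → δ Fin.zero u (h u)) ≡⟨ ∑Fin-suc d (λ u → δ Fin.zero u (h u)) ⟩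
    h Fin.zero + ∑Fin d (λ _ → 0ℚ)           ≡⟨ cong (h Fin.zero +_) (∑-zero (allFin d)) ⟩
    h Fin.zero + 0ℚ                          ≡⟨ ℚ.+-identityʳ _ ⟩
    h Fin.zero                               ∎
  where open ≡-Reasoning
∑Fin-δ (suc d) (Fin.suc a) h = begin
    ∑Fin (suc d) (λ u → δ (Fin.suc a) u (h u)) ≡⟨ ∑Fin-suc d (λ u → δ (Fin.suc a) u (h u)) ⟩
    0ℚ + ∑Fin d (λ u → δ a u (h (Fin.suc u)))  ≡⟨ ℚ.+-identityˡ _ ⟩
    ∑Fin d (λ u → δ a u (h (Fin.suc u)))       ≡⟨ ∑Fin-δ d a (h ∘ Fin.suc) ⟩
    h (Fin.suc a)                              ∎
  where open ≡-Reasoning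

-- For nonnegative f, a sum over distinct elements of Fin n is at most the
-- sum over all of Fin n: peel off the head a as the point mass at a.
∑-distinct≤∑Fin : ∀ {n} (W : List (Fin n)) → Unique W → (f : Fin n → ℚ) → (∀ u → 0ℚ ≤ f u) →
  ∑ W f ≤ ∑Fin n f
∑-distinct≤∑Fin {n} []      _ f f≥0 = ∑-nonneg (allFin n) f≥0
∑-distinct≤∑Fin {n} (a ∷ W) (a∉W ∷ W-unique) f f≥0 = begin
    f a + ∑ W f                            ≡⟨ cong (f a +_) (∑-congᴬ (All.map f≡f-a a∉W)) ⟩
    f a + ∑ W f-a                          ≤⟨ ℚ.+-monoʳ-≤ (f a) (∑-distinct≤∑Fin W W-unique f-a f-a≥0) ⟩
    f a + ∑Fin n f-a                       ≡⟨ cong (_+ ∑Fin n f-a) (sym (∑Fin-δ n a f)) ⟩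
    ∑Fin n (λ u → δ a u (f u)) + ∑Fin n f-a ≡⟨ sym (∑-+ (allFin n) _ _) ⟩
    ∑Fin n (λ u → δ a u (f u) + f-a u)      ≡⟨ ∑-cong (allFin n) recombine ⟩
    ∑Fin n f                               ∎
  where
  open ℚ.≤-Reasoning
  f-a : Fin n → ℚ
  f-a u = if does (a ≟ u) then 0ℚ else f u
  f≡f-a : ∀ {w} → ¬ a ≡ w → f w ≡ f-a w
  f≡f-a {w} a≢w rewrite dec-false (a ≟ w) a≢w = refl
  f-a≥0 : ∀ u → 0ℚ ≤ f-a u
  f-a≥0 u with does (a ≟ u)
  ... | true  = ℚ.≤-refl
  ... | false = f≥0 u
  recombine : ∀ u → δ a u (f u) + f-a u ≡ f u
  recombine u with does (a ≟ u)
  ... | true  = ℚ.+-identityʳ _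
  ... | false = ℚ.+-identityˡ _

0≤1 : 0ℚ ≤ 1ℚ
0≤1 = ℚ.≤ᵇ⇒≤ tt

½≤1 : ½ ≤ 1ℚ
½≤1 = ℚ.≤ᵇ⇒≤ tt

1≤2 : 1ℚ ≤ fromℕℚ 2
1≤2 = ℚ.≤ᵇ⇒≤ tt

-- fromℕℚ k = k/1 is already normalised, so this is an identity of integers.
fromℕℚ-suc : ∀ k → fromℕℚ (suc k) ≡ 1ℚ + fromℕℚ k
fromℕℚ-suc k rewrite ℚ.normalize-coprime (Coprime.sym (Coprime.1-coprimeTo k)) =
  cong (ℚ._/ 1) (sym (cong (ℤ._+_ (ℤ.+ 1)) (trans (ℤ.+◃n≡+n (k ℕ.* 1)) (cong ℤ.+_ (ℕ.*-identityʳ k)))))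

fromℕℚ-+ : ∀ a b → fromℕℚ (a ℕ.+ b) ≡ fromℕℚ a + fromℕℚ b
fromℕℚ-+ zero    b = sym (ℚ.+-identityˡ _)
fromℕℚ-+ (suc a) b = begin
    fromℕℚ (suc (a ℕ.+ b))         ≡⟨ fromℕℚ-suc (a ℕ.+ b) ⟩
    1ℚ + fromℕℚ (a ℕ.+ b)          ≡⟨ cong (1ℚ +_) (fromℕℚ-+ a b) ⟩
    1ℚ + (fromℕℚ a + fromℕℚ b)     ≡⟨ sym (ℚ.+-assoc 1ℚ (fromℕℚ a) (fromℕℚ b)) ⟩
    (1ℚ + fromℕℚ a) + fromℕℚ b     ≡⟨ cong (_+ fromℕℚ b) (sym (fromℕℚ-suc a)) ⟩
    fromℕℚ (suc a) + fromℕℚ b      ∎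
  where open ≡-Reasoning

fromℕℚ-mono : ∀ {a b} → a ℕ.≤ b → fromℕℚ a ≤ fromℕℚ b
fromℕℚ-mono = mono′ ∘ ℕ.≤⇒≤′
  where
  mono′ : ∀ {a b} → a ℕ.≤′ b → fromℕℚ a ≤ fromℕℚ b
  mono′ ℕ.≤′-refl           = ℚ.≤-refl
  mono′ (ℕ.≤′-step {b} a≤b) = ℚ.≤-trans (mono′ a≤b)
    (subst (fromℕℚ b ≤_) (sym (fromℕℚ-suc b))
      (subst (_≤ 1ℚ + fromℕℚ b) (ℚ.+-identityˡ _) (ℚ.+-monoˡ-≤ (fromℕℚ b) 0≤1)))

∑Fin-const : ∀ d c → ∑Fin d (λ _ → c) ≡ fromℕℚ d * c
∑Fin-const zero    c = sym (ℚ.*-zeroˡ c)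
∑Fin-const (suc d) c = begin
    ∑Fin (suc d) (λ _ → c)         ≡⟨ ∑Fin-suc d (λ _ → c) ⟩
    c + ∑Fin d (λ _ → c)           ≡⟨ cong₂ _+_ (sym (ℚ.*-identityˡ c)) (∑Fin-const d c) ⟩
    1ℚ * c + fromℕℚ d * c          ≡⟨ sym (ℚ.*-distribʳ-+ c 1ℚ (fromℕℚ d)) ⟩
    (1ℚ + fromℕℚ d) * c            ≡⟨ cong (_* c) (sym (fromℕℚ-suc d)) ⟩
    fromℕℚ (suc d) * c             ∎
  where open ≡-Reasoning

pow½≥0 : ∀ j → 0ℚ ≤ pow½ j
pow½≥0 zero    = 0≤1
pow½≥0 (suc j) = subst (_≤ ½ * pow½ j) (ℚ.*-zeroʳ ½) (ℚ.*-monoˡ-≤-nonNeg ½ (pow½≥0 j))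

pow½-suc≤ : ∀ j → pow½ (suc j) ≤ pow½ j
pow½-suc≤ j = subst (½ * pow½ j ≤_) (ℚ.*-identityˡ (pow½ j))
  (ℚ.*-monoʳ-≤-nonNeg (pow½ j) {{ℚ.nonNegative (pow½≥0 j)}} ½≤1)

pow½-antitone : ∀ {j k} → j ℕ.≤ k → pow½ k ≤ pow½ j
pow½-antitone = antitone′ ∘ ℕ.≤⇒≤′
  where
  antitone′ : ∀ {j k} → j ℕ.≤′ k → pow½ k ≤ pow½ j
  antitone′ ℕ.≤′-refl           = ℚ.≤-refl
  antitone′ (ℕ.≤′-step {k} j≤k) = ℚ.≤-trans (pow½-suc≤ k) (antitone′ j≤k)

pow½≤1 : ∀ j → pow½ j ≤ 1ℚ
pow½≤1 j = pow½-antitone {0} {j} z≤n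

-- Decrementing an exponent at most doubles the value (exactly, unless it is 0).
pow½-pred≤ : ∀ j → pow½ (j ∸ 1) ≤ fromℕℚ 2 * pow½ j
pow½-pred≤ zero    = 1≤2
pow½-pred≤ (suc j) = ℚ.≤-reflexive (sym (begin
    fromℕℚ 2 * (½ * pow½ j)   ≡⟨ ℚ.*-assoc (fromℕℚ 2) ½ (pow½ j) ⟨
    (fromℕℚ 2 * ½) * pow½ j   ≡⟨ ℚ.*-identityˡ (pow½ j) ⟩
    pow½ j                    ∎))
  where open ≡-Reasoning

2^k*pow½k≡1 : ∀ k → fromℕℚ (2 ^ k) * pow½ k ≡ 1ℚ
2^k*pow½k≡1 zero    = refl
2^k*pow½k≡1 (suc k) = begin
    fromℕℚ (2 ^ k ℕ.+ (2 ^ k ℕ.+ 0)) * (½ * pow½ k)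
      ≡⟨ cong (_* (½ * pow½ k)) (trans (fromℕℚ-+ (2 ^ k) _) (cong (A +_) (fromℕℚ-+ (2 ^ k) 0))) ⟩
    (A + (A + 0ℚ)) * (½ * pow½ k)   ≡⟨ halves A (pow½ k) ⟩
    A * pow½ k                      ≡⟨ 2^k*pow½k≡1 k ⟩
    1ℚ                              ∎
  where
  open ≡-Reasoning
  open +-*-Solver
  A = fromℕℚ (2 ^ k)
  halves : ∀ a p → (a + (a + 0ℚ)) * (½ * p) ≡ a * p
  halves = solve 2 (λ a p → (a :+ (a :+ con 0ℚ)) :* (con ½ :* p) := a :* p) refl

≤2^k⇒load≤1 : ∀ d k → d ℕ.≤ 2 ^ k → fromℕℚ d * pow½ k ≤ 1ℚ
≤2^k⇒load≤1 d k d≤2^k = subst (fromℕℚ d * pow½ k ≤_) (2^k*pow½k≡1 k)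
  (ℚ.*-monoʳ-≤-nonNeg (pow½ k) {{ℚ.nonNegative (pow½≥0 k)}} (fromℕℚ-mono d≤2^k))

-- n ≤ 2^⌈log₂ n⌉: halving n (rounding up) decreases ⌈log₂ n⌉ by one.
n≤2^⌈log₂n⌉ : ∀ n → n ℕ.≤ 2 ^ ⌈log₂ n ⌉
n≤2^⌈log₂n⌉ = <-rec (λ n → n ℕ.≤ 2 ^ ⌈log₂ n ⌉) bound
  where
  bound : ∀ n → (∀ {m} → m ℕ.< n → m ℕ.≤ 2 ^ ⌈log₂ m ⌉) → n ℕ.≤ 2 ^ ⌈log₂ n ⌉
  bound zero             _  = z≤n
  bound (suc zero)       _  = ℕ.≤-reflexive (cong (2 ^_) (sym (⌈log₂2^n⌉≡n 0)))
  bound n@(suc (suc m)) ih = begin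
      n                                 ≡⟨ ℕ.⌊n/2⌋+⌈n/2⌉≡n n ⟨
      ℕ.⌊ n /2⌋ ℕ.+ h                   ≤⟨ ℕ.+-monoˡ-≤ h (ℕ.⌊n/2⌋≤⌈n/2⌉ n) ⟩
      h ℕ.+ h                           ≤⟨ ℕ.+-mono-≤ (ih (ℕ.⌈n/2⌉<n m)) (ih (ℕ.⌈n/2⌉<n m)) ⟩
      2 ^ ⌈log₂ h ⌉ ℕ.+ 2 ^ ⌈log₂ h ⌉
        ≡⟨ cong (λ k → 2 ^ k ℕ.+ 2 ^ k) (⌈log₂⌈n/2⌉⌉≡⌈log₂n⌉∸1 n) ⟩
      2 ^ (l ∸ 1) ℕ.+ 2 ^ (l ∸ 1)       ≡⟨ cong (2 ^ (l ∸ 1) ℕ.+_) (sym (ℕ.+-identityʳ _)) ⟩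
      2 ^ suc (l ∸ 1)                   ≡⟨ cong (2 ^_) (ℕ.m+[n∸m]≡n l≥1) ⟩
      2 ^ l                             ∎
    where
    open ℕ.≤-Reasoning
    h = ℕ.⌈ n /2⌉
    l = ⌈log₂ n ⌉
    l≥1 : 1 ℕ.≤ l
    l≥1 = subst (ℕ._≤ l) (⌈log₂2^n⌉≡n 1) (⌈log₂⌉-mono-≤ {2} {n} (s≤s (s≤s z≤n)))

deg≤maxDeg : ∀ {n} (G : Graph n) v → deg G v ℕ.≤ maxDeg G
deg≤maxDeg {n} G v = ≤max (∈-allFin v)
  where
  ≤max : ∀ {xs} → v ∈ xs → deg G v ℕ.≤ foldr _⊔_ 0 (map (deg G) xs)
  ≤max (here refl)           = ℕ.m≤m⊔n _ _
  ≤max {w ∷ _} (there v∈xs)  = ℕ.≤-trans (≤max v∈xs) (ℕ.m≤n⊔m (deg G w) _)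

module _ {n : ℕ} (G : Graph n) (P : PortNumbering G) where

  ∑-ports : ∀ v (h : Fin n → ℚ) →
    ∑Fin (deg G v) (h ∘ nbr P v) ≡ ∑Fin n (λ u → if E G v u then h u else 0ℚ)
  ∑-ports v h = sym (begin
      ∑Fin n (λ u → if E G v u then h u else 0ℚ)          ≡⟨ ∑-cong (allFin n) neighbour-via-ports ⟩
      ∑Fin n (λ u → ∑Fin d (λ p → δ (nbr P v p) u (h u))) ≡⟨ ∑-swap (allFin n) (allFin d) _ ⟩
      ∑Fin d (λ p → ∑Fin n (λ u → δ (nbr P v p) u (h u)))
        ≡⟨ ∑-cong (allFin d) (λ p → ∑Fin-δ n (nbr P v p) h) ⟩
      ∑Fin d (h ∘ nbr P v)                                ∎)
    where
    open ≡-Reasoning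
    d = deg G v
    -- a neighbour u of v is reached through exactly one port, a non-neighbour through none
    neighbour-via-ports : ∀ u → (if E G v u then h u else 0ℚ) ≡ ∑Fin d (λ p → δ (nbr P v p) u (h u))
    neighbour-via-ports u with E G v u in vu
    ... | true = let (p₀ , p₀↦u) = nbr-surj P v u vu in begin
        h u                                ≡⟨ ∑Fin-δ d p₀ (λ _ → h u) ⟨
        ∑Fin d (λ p → δ p₀ p (h u))        ≡⟨ ∑-cong (allFin d) (only-port p₀ p₀↦u) ⟩
        ∑Fin d (λ p → δ (nbr P v p) u (h u)) ∎
      where
      only-port : ∀ p₀ → nbr P v p₀ ≡ u → ∀ p → δ p₀ p (h u) ≡ δ (nbr P v p) u (h u)
      only-port p₀ p₀↦u p with p₀ ≟ p
      ... | yes refl = sym (δ-≡ p₀↦u)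
      ... | no p₀≢p  = sym (δ-≢ (λ p↦u → p₀≢p (nbr-inj P v (trans p₀↦u (sym p↦u)))))
    ... | false = sym (trans (∑-cong (allFin d) no-port) (∑-zero (allFin d)))
      where
      no-port : ∀ p → δ (nbr P v p) u (h u) ≡ 0ℚ
      no-port p = δ-≢ λ p↦u → true≢false (trans (sym (nbr-adj P v p)) (trans (cong (E G v) p↦u) vu))
        where
        true≢false : ¬ true ≡ false
        true≢false ()

  -- below v u c keeps c only for v < u: it selects each edge at one endpoint.
  below : Fin n → Fin n → ℚ → ℚ
  below v u c = if does (v <? u) then c else 0ℚ

  module SymmetricWeight (g : Fin n → Fin n → ℚ) (g-sym : ∀ v u → g v u ≡ g u v)
                         (x : (v : Fin n) → Fin (deg G v) → ℚ)
                         (x≗g : ∀ v p → x v p ≡ g v (nbr P v p)) where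
    open Assignment G P x

    consistent : Consistent
    consistent v p = begin
        x (nbr P v p) (back P v p)            ≡⟨ x≗g (nbr P v p) (back P v p) ⟩
        g (nbr P v p) (nbr P (nbr P v p) (back P v p)) ≡⟨ cong (g (nbr P v p)) (back-ok P v p) ⟩
        g (nbr P v p) v                       ≡⟨ g-sym (nbr P v p) v ⟩
        g v (nbr P v p)                       ≡⟨ x≗g v p ⟨
        x v p                                 ∎
      where open ≡-Reasoning

    w : Fin n → Fin n → ℚ
    w v u = if E G v u then g v u else 0ℚ

    w-sym : ∀ v u → w v u ≡ w u v
    w-sym v u rewrite Graph.sym G v u | g-sym v u = refl

    w-split : ∀ v u → w v u ≡ below v u (w v u) + below u v (w v u)
    w-split v u with Fin.<-cmp v u
    ... | tri< v<u _ u≮v rewrite dec-true (v <? u) v<u | dec-false (u <? v) u≮v = sym (ℚ.+-identityʳ _)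
    ... | tri> v≮u _ u<v rewrite dec-false (v <? u) v≮u | dec-true (u <? v) u<v = sym (ℚ.+-identityˡ _)
    ... | tri≈ v≮u refl _ rewrite dec-false (v <? v) v≮u | irrefl G v = refl

    UpperSum : ℚ
    UpperSum = ∑Fin n (λ v → ∑Fin n (λ u → below v u (w v u)))

    total≡UpperSum : total ≡ UpperSum
    total≡UpperSum = begin
        total
      ≡⟨ ∑-concatMap (allFin n) _ ⟩
        ∑Fin n (λ v → ∑ (filter (λ p → v <? nbr P v p) (allFin (deg G v))) (x v))
      ≡⟨ ∑-cong (allFin n) (λ v → ∑-filter (λ p → v <? nbr P v p) (allFin (deg G v)) (x v)) ⟩
        ∑Fin n (λ v → ∑Fin (deg G v) (λ p → below v (nbr P v p) (x v p)))
      ≡⟨ ∑-cong (allFin n) (λ v → ∑-cong (allFin (deg G v)) (λ p → cong (below v (nbr P v p)) (x≗g v p))) ⟩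
        ∑Fin n (λ v → ∑Fin (deg G v) (λ p → below v (nbr P v p) (g v (nbr P v p))))
      ≡⟨ ∑-cong (allFin n) (λ v → ∑-ports v (λ u → below v u (g v u))) ⟩
        ∑Fin n (λ v → ∑Fin n (λ u → if E G v u then below v u (g v u) else 0ℚ))
      ≡⟨ ∑-cong (allFin n) (λ v → ∑-cong (allFin n) (below-outside v)) ⟩
        UpperSum
      ∎
      where
      open ≡-Reasoning
      below-outside : ∀ v u → (if E G v u then below v u (g v u) else 0ℚ) ≡ below v u (w v u)
      below-outside v u with E G v u | does (v <? u)
      ... | true  | _     = refl
      ... | false | true  = refl
      ... | false | false = refl

    ∑load≡2total : ∑Fin n load ≡ total + total
    ∑load≡2total = begin
        ∑Fin n load
      ≡⟨ ∑-cong (allFin n) (λ v → trans (∑-cong (allFin (deg G v)) (x≗g v)) (∑-ports v (g v))) ⟩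
        ∑Fin n (λ v → ∑Fin n (w v))
      ≡⟨ ∑-cong (allFin n) (λ v → trans (∑-cong (allFin n) (w-split v)) (∑-+ (allFin n) _ _)) ⟩
        ∑Fin n (λ v → ∑Fin n (λ u → below v u (w v u)) + ∑Fin n (λ u → below u v (w v u)))
      ≡⟨ ∑-+ (allFin n) _ _ ⟩
        UpperSum + ∑Fin n (λ v → ∑Fin n (λ u → below u v (w v u)))
      ≡⟨ cong (UpperSum +_) (∑-swap (allFin n) (allFin n) (λ v u → below u v (w v u))) ⟩
        UpperSum + ∑Fin n (λ u → ∑Fin n (λ v → below u v (w v u)))
      ≡⟨ cong (UpperSum +_) (∑-cong (allFin n) λ u → ∑-cong (allFin n) λ v → cong (below u v) (w-sym v u)) ⟩
        UpperSum + UpperSum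
      ≡⟨ cong₂ _+_ total≡UpperSum total≡UpperSum ⟨
        total + total
      ∎
      where open ≡-Reasoning

module _ {n : ℕ} (G : Graph n) (ℓ : Fin n → ℚ) (ℓ≥0 : ∀ v → 0ℚ ≤ ℓ v)
         (covered : ∀ a b → E G a b ≡ true → ½ ≤ ℓ a ⊎ ½ ≤ ℓ b) where

  edge-load : ∀ a b → E G a b ≡ true → ½ ≤ ℓ a + ℓ b
  edge-load a b ab with covered a b ab
  ... | inj₁ ½≤ℓa = subst (_≤ ℓ a + ℓ b) (ℚ.+-identityʳ ½) (ℚ.+-mono-≤ ½≤ℓa (ℓ≥0 b))
  ... | inj₂ ½≤ℓb = subst (_≤ ℓ a + ℓ b) (ℚ.+-identityˡ ½) (ℚ.+-mono-≤ (ℓ≥0 a) ½≤ℓb)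

  half-size≤∑endpoints : ∀ M → All (λ e → E G (proj₁ e) (proj₂ e) ≡ true) M →
    ½ * fromℕℚ (length M) ≤ ∑ (endpoints M) ℓ
  half-size≤∑endpoints []            []       = ℚ.≤-refl
  half-size≤∑endpoints ((a , b) ∷ M) (ab ∷ M-edges) = begin
      ½ * fromℕℚ (suc (length M))        ≡⟨ cong (½ *_) (fromℕℚ-suc (length M)) ⟩
      ½ * (1ℚ + fromℕℚ (length M))       ≡⟨ ℚ.*-distribˡ-+ ½ 1ℚ (fromℕℚ (length M)) ⟩
      ½ + ½ * fromℕℚ (length M)          ≤⟨ ℚ.+-mono-≤ (edge-load a b ab) (half-size≤∑endpoints M M-edges) ⟩
      (ℓ a + ℓ b) + ∑ (endpoints M) ℓ    ≡⟨ ℚ.+-assoc (ℓ a) (ℓ b) _ ⟩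
      ℓ a + (ℓ b + ∑ (endpoints M) ℓ)    ∎
    where open ℚ.≤-Reasoning

  matching≤4t : (t : ℚ) → ∑Fin n ℓ ≡ t + t → ∀ M → IsMatching G M → fromℕℚ (length M) ≤ fromℕℚ 4 * t
  matching≤4t t ∑ℓ≡2t M (M-edges , M-distinct) = begin
      fromℕℚ (length M)                  ≡⟨ double-half (fromℕℚ (length M)) ⟨
      fromℕℚ 2 * (½ * fromℕℚ (length M)) ≤⟨ ℚ.*-monoˡ-≤-nonNeg (fromℕℚ 2) half≤∑ ⟩
      fromℕℚ 2 * ∑Fin n ℓ                ≡⟨ cong (fromℕℚ 2 *_) ∑ℓ≡2t ⟩
      fromℕℚ 2 * (t + t)                 ≡⟨ double-sum t ⟩
      fromℕℚ 4 * t                       ∎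
    where
    open ℚ.≤-Reasoning
    open +-*-Solver
    half≤∑ : ½ * fromℕℚ (length M) ≤ ∑Fin n ℓ
    half≤∑ = ℚ.≤-trans (half-size≤∑endpoints M M-edges)
                       (∑-distinct≤∑Fin (endpoints M) M-distinct ℓ ℓ≥0)
    double-half : ∀ q → fromℕℚ 2 * (½ * q) ≡ q
    double-half = solve 1 (λ q → con (fromℕℚ 2) :* (con ½ :* q) := q) refl
    double-sum : ∀ q → fromℕℚ 2 * (q + q) ≡ fromℕℚ 4 * q
    double-sum = solve 1 (λ q → con (fromℕℚ 2) :* (q :+ q) := con (fromℕℚ 4) :* q) refl

light? : ℚ → Bool
light? c = does (c ℚ.<? ½)

nextExponent : ℚ → ℚ → ℕ → ℕ
nextExponent a b j = if light? a ∧ light? b then j ∸ 1 else j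

nextExponent-sym : ∀ a b j → nextExponent a b j ≡ nextExponent b a j
nextExponent-sym a b j = cong (λ both → if both then j ∸ 1 else j) (∧-comm (light? a) (light? b))

nextExponent-≤ : ∀ a b j → nextExponent a b j ℕ.≤ j
nextExponent-≤ a b j with light? a ∧ light? b
... | true  = ℕ.m∸n≤m j 1
... | false = ℕ.≤-refl

nextExponent-heavy : ∀ {a} b j → ¬ a < ½ → nextExponent a b j ≡ j
nextExponent-heavy {a} b j a≮½ rewrite dec-false (a ℚ.<? ½) a≮½ = refl

nextExponent-light : ∀ {a b} j → a < ½ → b < ½ → nextExponent a b j ≡ j ∸ 1
nextExponent-light {a} {b} j a<½ b<½ rewrite dec-true (a ℚ.<? ½) a<½ | dec-true (b ℚ.<? ½) b<½ = refl

pow½-nextExponent≤ : ∀ a b j → pow½ (nextExponent a b j) ≤ fromℕℚ 2 * pow½ j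
pow½-nextExponent≤ a b j with light? a ∧ light? b
... | true  = pow½-pred≤ j
... | false = subst (_≤ fromℕℚ 2 * pow½ j) (ℚ.*-identityˡ (pow½ j))
                (ℚ.*-monoʳ-≤-nonNeg (pow½ j) {{ℚ.nonNegative (pow½≥0 j)}} 1≤2)

module Phases {n : ℕ} (G : Graph n) (P : PortNumbering G) where

  mutual
    -- exponent t v u: the edge vu has value 2^{-exponent t v u} after t phases
    exponent : ℕ → Fin n → Fin n → ℕ
    exponent zero    v u = ⌈log₂ (deg G v ⊔ deg G u) ⌉
    exponent (suc t) v u = nextExponent (loadAt t v) (loadAt t u) (exponent t v u)

    loadAt : ℕ → Fin n → ℚ
    loadAt t v = ∑Fin (deg G v) (λ p → pow½ (exponent t v (nbr P v p)))

  exponent-sym : ∀ t v u → exponent t v u ≡ exponent t u v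
  exponent-sym zero    v u = cong ⌈log₂_⌉ (ℕ.⊔-comm (deg G v) (deg G u))
  exponent-sym (suc t) v u =
    trans (nextExponent-sym (loadAt t v) (loadAt t u) _)
          (cong (nextExponent (loadAt t u) (loadAt t v)) (exponent-sym t v u))

  exponent-decreasing : ∀ t v u → exponent t v u ℕ.≤ exponent zero v u
  exponent-decreasing zero    v u = ℕ.≤-refl
  exponent-decreasing (suc t) v u =
    ℕ.≤-trans (nextExponent-≤ (loadAt t v) (loadAt t u) _) (exponent-decreasing t v u)

  exponent≤⌈log₂Δ⌉ : ∀ t v u → exponent t v u ℕ.≤ ⌈log₂ maxDeg G ⌉
  exponent≤⌈log₂Δ⌉ t v u = ℕ.≤-trans (exponent-decreasing t v u)
    (⌈log₂⌉-mono-≤ (ℕ.⊔-lub (deg≤maxDeg G v) (deg≤maxDeg G u)))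

  loadAt≥0 : ∀ t v → 0ℚ ≤ loadAt t v
  loadAt≥0 t v = ∑-nonneg (allFin (deg G v)) (λ p → pow½≥0 (exponent t v (nbr P v p)))

  -- values only grow, so loads only grow
  loadAt-mono : ∀ t v → loadAt t v ≤ loadAt (suc t) v
  loadAt-mono t v = ∑-mono (allFin (deg G v)) λ p →
    pow½-antitone (nextExponent-≤ (loadAt t v) (loadAt t (nbr P v p)) _)

  -- initially, each of the d edges at v has value ≤ 2^{-⌈log₂ d⌉}
  loadAt-zero≤1 : ∀ v → loadAt zero v ≤ 1ℚ
  loadAt-zero≤1 v = begin
      loadAt zero v
        ≤⟨ ∑-mono (allFin d) (λ p → pow½-antitone (⌈log₂⌉-mono-≤ (ℕ.m≤m⊔n d (deg G (nbr P v p))))) ⟩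
      ∑Fin d (λ _ → pow½ ⌈log₂ d ⌉)   ≡⟨ ∑Fin-const d _ ⟩
      fromℕℚ d * pow½ ⌈log₂ d ⌉       ≤⟨ ≤2^k⇒load≤1 d ⌈log₂ d ⌉ (n≤2^⌈log₂n⌉ d) ⟩
      1ℚ                              ∎
    where
    open ℚ.≤-Reasoning
    d = deg G v

  -- A heavy node keeps its load; a light one at most doubles it (to < 1).
  loadAt≤1 : ∀ t v → loadAt t v ≤ 1ℚ
  loadAt≤1 zero    v = loadAt-zero≤1 v
  loadAt≤1 (suc t) v with loadAt t v ℚ.<? ½
  ... | no  heavy = subst (_≤ 1ℚ) (sym unchanged) (loadAt≤1 t v)
    where
    unchanged : loadAt (suc t) v ≡ loadAt t v
    unchanged = ∑-cong (allFin (deg G v)) λ p →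
      cong pow½ (nextExponent-heavy (loadAt t (nbr P v p)) _ heavy)
  ... | yes light = begin
      loadAt (suc t) v
        ≤⟨ ∑-mono (allFin (deg G v)) (λ p → pow½-nextExponent≤ (loadAt t v) (loadAt t (nbr P v p)) _) ⟩
      ∑Fin (deg G v) (λ p → fromℕℚ 2 * pow½ (exponent t v (nbr P v p)))
        ≡⟨ ∑-*ˡ (allFin (deg G v)) (fromℕℚ 2) _ ⟩
      fromℕℚ 2 * loadAt t v             ≤⟨ ℚ.*-monoˡ-≤-nonNeg (fromℕℚ 2) (ℚ.<⇒≤ light) ⟩
      fromℕℚ 2 * ½                      ≡⟨⟩
      1ℚ                                ∎
    where open ℚ.≤-Reasoning

  Covered : ℕ → Fin n → Fin n → Set
  Covered t v u = ½ ≤ loadAt t v ⊎ ½ ≤ loadAt t u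

  covered-mono : ∀ {t v u} → Covered t v u → Covered (suc t) v u
  covered-mono {t} {v} {u} (inj₁ ½≤v) = inj₁ (ℚ.≤-trans ½≤v (loadAt-mono t v))
  covered-mono {t} {v} {u} (inj₂ ½≤u) = inj₂ (ℚ.≤-trans ½≤u (loadAt-mono t u))

  -- An edge of value 1 = 2^{-0} makes its endpoint heavy.
  light⇒exponent≥1 : ∀ t v p → loadAt t v < ½ → 1 ℕ.≤ exponent t v (nbr P v p)
  light⇒exponent≥1 t v p light with exponent t v (nbr P v p) in e≡
  ... | suc _ = s≤s z≤n
  ... | zero  = ⊥-elim (ℚ.<-irrefl refl (ℚ.≤-<-trans ½≤1 (ℚ.≤-<-trans 1≤load light)))
    where
    1≤load : 1ℚ ≤ loadAt t v
    1≤load = subst (λ j → pow½ j ≤ loadAt t v) e≡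
      (term≤∑ (λ q → pow½≥0 (exponent t v (nbr P v q))) (∈-allFin p))

  -- Progress: after t phases an edge is covered, or it has doubled in every phase.
  progress : ∀ t v p → let u = nbr P v p in
    Covered t v u ⊎ t ℕ.+ exponent t v u ℕ.≤ exponent zero v u
  progress zero    v p = inj₂ ℕ.≤-refl
  progress (suc t) v p with progress t v p
  ... | inj₁ covered = inj₁ (covered-mono {t} covered)
  ... | inj₂ doubled with loadAt t v ℚ.<? ½ | loadAt t (nbr P v p) ℚ.<? ½
  ...   | no v-heavy  | _           = inj₁ (covered-mono {t} (inj₁ (ℚ.≮⇒≥ v-heavy)))
  ...   | yes _       | no u-heavy  = inj₁ (covered-mono {t} (inj₂ (ℚ.≮⇒≥ u-heavy)))
  ...   | yes v-light | yes u-light = inj₂ (begin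
      suc t ℕ.+ exponent (suc t) v u   ≡⟨ cong (suc t ℕ.+_) (nextExponent-light (exponent t v u) v-light u-light) ⟩
      suc (t ℕ.+ (exponent t v u ∸ 1)) ≡⟨ ℕ.+-suc t _ ⟨
      t ℕ.+ suc (exponent t v u ∸ 1)   ≡⟨ cong (t ℕ.+_) (ℕ.m+[n∸m]≡n (light⇒exponent≥1 t v p v-light)) ⟩
      t ℕ.+ exponent t v u             ≤⟨ doubled ⟩
      exponent zero v u                ∎)
    where
    open ℕ.≤-Reasoning
    u = nbr P v p

  eventually-covered : ∀ t → ⌈log₂ maxDeg G ⌉ ℕ.< t → ∀ v p → Covered t v (nbr P v p)
  eventually-covered t log<t v p with progress t v p
  ... | inj₁ covered = covered
  ... | inj₂ doubled = ⊥-elim (ℕ.<⇒≱ log<t (begin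
      t                              ≤⟨ ℕ.m≤m+n t _ ⟩
      t ℕ.+ exponent t v u           ≤⟨ doubled ⟩
      exponent zero v u              ≤⟨ exponent≤⌈log₂Δ⌉ zero v u ⟩
      ⌈log₂ maxDeg G ⌉               ∎))
    where
    open ℕ.≤-Reasoning
    u = nbr P v p

record NodeState : Set where
  constructor node
  field
    estimate  : ℕ
    clock     : ℕ
    exponents : ℕ → ℕ    -- exponent of the edge at port p, indexed by toℕ p

open NodeState

phases : ℕ → ℕ → ℕ
phases κ Λ = suc (κ ℕ.* Λ)

-- A function on ports extended by 0 to all of ℕ (the state type cannot
-- depend on the degree).
portwise : (d : ℕ) → (Fin d → ℕ) → ℕ → ℕ
portwise d f k with k ℕ.<? d
... | yes k<d = f (fromℕ< k<d)
... | no  _   = 0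

portwise-toℕ : ∀ d (f : Fin d → ℕ) p → portwise d f (toℕ p) ≡ f p
portwise-toℕ d f p with toℕ p ℕ.<? d
... | yes p<d = cong f (Fin.fromℕ<-toℕ p p<d)
... | no  p≮d = ⊥-elim (p≮d (Fin.toℕ<n p))

ownLoad : (d : ℕ) → (ℕ → ℕ) → ℚ
ownLoad d e = ∑Fin d (λ p → pow½ (e (toℕ p)))

advance : (d : ℕ) → NodeState → (Fin d → ℕ × ℚ) → NodeState
advance d (node Λ zero    _) msg = node Λ 1 (portwise d λ p → ⌈log₂ (d ⊔ proj₁ (msg p)) ⌉)
advance d (node Λ (suc c) e) msg =
  node Λ (suc (suc c)) (portwise d λ p → nextExponent (ownLoad d e) (proj₂ (msg p)) (e (toℕ p)))

halts? : ℕ → NodeState → Bool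
halts? κ s = does (suc (phases κ (estimate s)) ℕ.≤? clock s)

algorithm : ℕ → LocalAlgorithm
algorithm κ = record
  { State  = NodeState
  ; Msg    = ℕ × ℚ                       -- (degree, current load)
  ; init   = λ Λ _ _ → node Λ 0 (λ _ → 0)
  ; send   = λ d s _ → d , ownLoad d (exponents s)
  ; update = advance
  ; output = λ d s → if halts? κ s then just (λ p → pow½ (exponents s (toℕ p))) else nothing
  }

module Execution (κ : ℕ) {n : ℕ} (G : Graph n) (P : PortNumbering G)
                 (ID : Fin n → ℕ) (Λ : ℕ) where
  open Run (algorithm κ) G P ID Λ
  open Phases G P

  K : ℕ
  K = phases κ Λ

  -- s holds the exponents of v after t phases (s is v's state after round t + 1)
  Tracks : ℕ → Fin n → NodeState → Set
  Tracks t v s = estimate s ≡ Λ × clock s ≡ suc t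
               × (∀ p → exponents s (toℕ p) ≡ exponent t v (nbr P v p))

  ownLoad≡loadAt : ∀ t u e → (∀ p → e (toℕ p) ≡ exponent t u (nbr P u p)) →
    ownLoad (deg G u) e ≡ loadAt t u
  ownLoad≡loadAt t u e e≗ = ∑-cong (allFin (deg G u)) (λ p → cong pow½ (e≗ p))

  phase-step : ∀ t v (s : NodeState) (msg : Fin (deg G v) → ℕ × ℚ) → suc t ℕ.≤ K → Tracks t v s →
    (∀ p → proj₂ (msg p) ≡ loadAt t (nbr P v p)) →
    Tracks (suc t) v (step v (output (algorithm κ) (deg G v) s) s msg)
  phase-step t v (node .Λ .(suc t) e) msg t<K (refl , refl , e≗) msg≗
    rewrite dec-false (suc K ℕ.≤? suc t) (ℕ.<⇒≱ (s≤s t<K)) = refl , refl , λ p → begin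
      portwise d (λ q → nextExponent (ownLoad d e) (proj₂ (msg q)) (e (toℕ q))) (toℕ p)
        ≡⟨ portwise-toℕ d _ p ⟩
      nextExponent (ownLoad d e) (proj₂ (msg p)) (e (toℕ p))
        ≡⟨ cong₂ (λ a j → nextExponent a (proj₂ (msg p)) j) (ownLoad≡loadAt t v e e≗) (e≗ p) ⟩
      nextExponent (loadAt t v) (proj₂ (msg p)) (exponent t v (nbr P v p))
        ≡⟨ cong (λ b → nextExponent (loadAt t v) b (exponent t v (nbr P v p))) (msg≗ p) ⟩
      exponent (suc t) v (nbr P v p)
        ∎
    where
    open ≡-Reasoning
    d = deg G v

  inbox : ℕ → (v : Fin n) → Fin (deg G v) → ℕ × ℚ
  inbox r v p = send (algorithm κ) (deg G (nbr P v p)) (state r (nbr P v p)) (back P v p)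

  tracks : ∀ t → t ℕ.≤ K → ∀ v → Tracks t v (state (suc t) v)
  tracks zero    _   v = refl , refl , portwise-toℕ _ _
  tracks (suc t) t<K v =
    phase-step t v (state (suc t) v) (inbox (suc t) v) t<K (tracks t t≤K v) received-loads
    where
    t≤K : t ℕ.≤ K
    t≤K = ℕ.≤-trans (ℕ.n≤1+n t) t<K
    received-loads : ∀ p → proj₂ (inbox (suc t) v p) ≡ loadAt t (nbr P v p)
    received-loads p = ownLoad≡loadAt t u (exponents (state (suc t) u)) (proj₂ (proj₂ (tracks t t≤K u)))
      where u = nbr P v p

  halts-after-K : ∀ v s → Tracks K v s → halts? κ s ≡ true
  halts-after-K v (node .Λ .(suc K) _) (refl , refl , _) = dec-true (suc K ℕ.≤? suc K) ℕ.≤-refl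

  halted : ∀ v → halts? κ (state (suc K) v) ≡ true
  halted v = halts-after-K v (state (suc K) v) (tracks K ℕ.≤-refl v)

  stays : ∀ v s msg → halts? κ s ≡ true → step v (output (algorithm κ) (deg G v) s) s msg ≡ s
  stays v s msg halts rewrite halts = refl

  frozen : ∀ r → suc K ℕ.≤ r → ∀ v → state r v ≡ state (suc K) v
  frozen r = frozen′ ∘ ℕ.≤⇒≤′
    where
    frozen′ : ∀ {r} → suc K ℕ.≤′ r → ∀ v → state r v ≡ state (suc K) v
    frozen′ ℕ.≤′-refl           v = refl
    frozen′ (ℕ.≤′-step {r} K<r) v = trans
      (stays v (state r v) _ (subst (λ s → halts? κ s ≡ true) (sym (frozen′ K<r v)) (halted v)))
      (frozen′ K<r v)

  x : (v : Fin n) → Fin (deg G v) → ℚ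
  x v p = pow½ (exponents (state (suc K) v) (toℕ p))

  output-after : ∀ r → suc K ℕ.≤ r → ∀ v → out r v ≡ just (x v)
  output-after r K<r v = trans (cong (output (algorithm κ) (deg G v)) (frozen r K<r v)) (emits (state (suc K) v) (halted v))
    where
    emits : ∀ s → halts? κ s ≡ true →
      output (algorithm κ) (deg G v) s ≡ just (λ p → pow½ (exponents s (toℕ p)))
    emits s halts rewrite halts = refl

  x≗final : ∀ v p → x v p ≡ pow½ (exponent K v (nbr P v p))
  x≗final v p = cong pow½ (proj₂ (proj₂ (tracks K ℕ.≤-refl v)) p)

  enough-rounds : Λ ℕ.≤ κ ℕ.* ⌈log₂ maxDeg G ⌉ →
    suc K ℕ.≤ (κ ℕ.* κ ℕ.+ 2) ℕ.* suc ⌈log₂ maxDeg G ⌉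
  enough-rounds Λ≤κL = begin
      2 ℕ.+ κ ℕ.* Λ                 ≤⟨ ℕ.+-monoʳ-≤ 2 (ℕ.*-monoʳ-≤ κ Λ≤κL) ⟩
      2 ℕ.+ κ ℕ.* (κ ℕ.* L)         ≡⟨ cong (2 ℕ.+_) (ℕ.*-assoc κ κ L) ⟨
      2 ℕ.+ κ ℕ.* κ ℕ.* L           ≤⟨ ℕ.+-mono-≤ (ℕ.m≤n+m 2 (κ ℕ.* κ))
                                                  (ℕ.*-monoˡ-≤ L (ℕ.m≤m+n (κ ℕ.* κ) 2)) ⟩
      C ℕ.+ C ℕ.* L                 ≡⟨ ℕ.*-suc C L ⟨
      C ℕ.* suc L                   ∎
    where
    open ℕ.≤-Reasoning
    L = ⌈log₂ maxDeg G ⌉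
    C = κ ℕ.* κ ℕ.+ 2

  open Assignment G P x
  open SymmetricWeight G P (λ v u → pow½ (exponent K v u)) (λ v u → cong pow½ (exponent-sym K v u))
                       x x≗final
    using (consistent; ∑load≡2total) public

  load≡loadAt : ∀ v → load v ≡ loadAt K v
  load≡loadAt v = ∑-cong (allFin (deg G v)) (x≗final v)

  fractional : IsFractionalMatching
  fractional =
      (λ v p → let j = exponent K v (nbr P v p) in
               subst (λ q → 0ℚ ≤ q × q ≤ 1ℚ) (sym (x≗final v p)) (pow½≥0 j , pow½≤1 j))
    , (λ v → subst (_≤ 1ℚ) (sym (load≡loadAt v)) (loadAt≤1 K v))

  pow-fractional : IsPowFractional ⌈log₂ maxDeg G ⌉
  pow-fractional v p = inj₂ (exponent K v (nbr P v p) , exponent≤⌈log₂Δ⌉ K v (nbr P v p) , x≗final v p)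

  -- with K > ⌈log₂ Δ⌉ phases every edge has a heavy endpoint
  four-approximate : ⌈log₂ maxDeg G ⌉ ℕ.≤ κ ℕ.* Λ →
    ∀ M → IsMaximumMatching G M → fromℕℚ (length M) ≤ fromℕℚ 4 * total
  four-approximate log≤κΛ M (M-matching , _) =
    matching≤4t G load load≥0 covered total ∑load≡2total M M-matching
    where
    load≥0 : ∀ v → 0ℚ ≤ load v
    load≥0 v = subst (0ℚ ≤_) (sym (load≡loadAt v)) (loadAt≥0 K v)
    covered : ∀ a b → E G a b ≡ true → ½ ≤ load a ⊎ ½ ≤ load b
    covered a b ab with nbr-surj P a b ab
    ... | p , refl with eventually-covered K (s≤s log≤κΛ) a p
    ...   | inj₁ a-heavy = inj₁ (subst (½ ≤_) (sym (load≡loadAt a)) a-heavy)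
    ...   | inj₂ b-heavy = inj₂ (subst (½ ≤_) (sym (load≡loadAt (nbr P a p))) b-heavy)

lemma4p5 : (κ : ℕ) → 1 ℕ.≤ κ →
    Σ LocalAlgorithm λ A → ∃ λ (C : ℕ) →
      ∀ {n} (G : Graph n) (P : PortNumbering G) (ID : Fin n → ℕ) → Injective _≡_ _≡_ ID →
      ∀ (Λ : ℕ) → ⌈log₂ maxDeg G ⌉ ℕ.≤ κ ℕ.* Λ → Λ ℕ.≤ κ ℕ.* ⌈log₂ maxDeg G ⌉ →
      Σ ((v : Fin n) → Fin (deg G v) → ℚ) λ x →
        (∀ v → Run.out A G P ID Λ (C ℕ.* suc ⌈log₂ maxDeg G ⌉) v ≡ just (x v))
        × Assignment.Consistent G P x
        × Assignment.IsFractionalMatching G P x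
        × Assignment.IsPowFractional G P x ⌈log₂ maxDeg G ⌉
        × (∀ M → IsMaximumMatching G M →
             fromℕℚ (length M) ℚ.≤ fromℕℚ 4 ℚ.* Assignment.total G P x)
lemma4p5 κ _ = algorithm κ , κ ℕ.* κ ℕ.+ 2 , λ G P ID _ Λ log≤κΛ Λ≤κlog →
  let open Execution κ G P ID Λ in
    x
  , output-after _ (enough-rounds Λ≤κlog)
  , consistent
  , fractional
  , pow-fractional
  , four-approximate log≤κΛ
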